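{- Let $F$ be a finite field of prime order at least $5$, let $G$ be a finite-dimensional vector space over $F$, and let $M_1,\dots,M_d:G\to\widehat G$ be self-adjoint linear transformations. Then there exists a linear subspace $\dot W$ of $G$ with \[\dim(\dot W)\geq\frac{1}{d+1}\dim(G)-\frac{2d}{d+1}\] such that $M_jx\cdot y=0$ for all $1\leq j\leq d$ and all $x,y\in\dot W$.
   Context: $\widehat G$ is the group of homomorphisms $\xi:G\to\mathbb{R}/\mathbb{Z}$, written $x\mapsto\xi\cdot x$. A linear map $M:G\to\widehat G$ is self-adjoint if $Mx\cdot y=My\cdot x$ for all $x,y\in G$. -}

module Defs where

open import Data.Nat using (ℕ; zero; suc)
open import Data.Integer using (ℤ; +_; _+_; _*_; _-_)
open import Data.Integer.Divisibility using (_∣_)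
open import Data.Fin using (Fin; zero; suc)

∑ : ∀ {n} → (Fin n → ℤ) → ℤ
∑ {zero}  f = + 0
∑ {suc n} f = f zero + ∑ (λ i → f (suc i))

-- The vector space G = F^n over F = ℤ/pℤ, elements represented by integer vectors.
Vec : ℕ → Set
Vec n = Fin n → ℤ

infix 4 _≈[_]_ _≈ᵥ[_]_
infixl 6 _+ᵥ_
infixl 7 _·ᵥ_

_≈[_]_ : ℤ → ℕ → ℤ → Set
a ≈[ p ] b = (+ p) ∣ (a - b)

_≈ᵥ[_]_ : ∀ {n} → Vec n → ℕ → Vec n → Set
x ≈ᵥ[ p ] y = ∀ i → x i ≈[ p ] y i

_+ᵥ_ : ∀ {n} → Vec n → Vec n → Vec n
(x +ᵥ y) i = x i + y i

_·ᵥ_ : ∀ {n} → ℤ → Vec n → Vec n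
(c ·ᵥ x) i = c * x i

-- Integer representative of the pairing; for ξ ∈ Ĝ ≅ F^n (ξ ↦ (x ↦ (∑ ξᵢ xᵢ)/p mod 1)),
-- ξ · x = 0 in ℝ/ℤ iff  dot ξ x ≈[ p ] 0.
dot : ∀ {n} → Vec n → Vec n → ℤ
dot ξ x = ∑ (λ i → ξ i * x i)

-- A map M : G → Ĝ (with Ĝ ≅ F^n via the pairing above) that is well defined and F-linear.
record IsLinear (p : ℕ) {n : ℕ} (M : Vec n → Vec n) : Set where
  field
    resp : ∀ x y → x ≈ᵥ[ p ] y → M x ≈ᵥ[ p ] M y
    additive : ∀ x y → M (x +ᵥ y) ≈ᵥ[ p ] (M x +ᵥ M y)
    homogeneous : ∀ (c : ℤ) x → M (c ·ᵥ x) ≈ᵥ[ p ] (c ·ᵥ M x)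

SelfAdjoint : ℕ → ∀ {n} → (Vec n → Vec n) → Set
SelfAdjoint p M = ∀ x y → dot (M x) y ≈[ p ] dot (M y) x

comb : ∀ {n k} → (Fin k → Vec n) → (Fin k → ℤ) → Vec n
comb v c j = ∑ (λ i → c i * v i j)

LinIndep : ℕ → ∀ {n k} → (Fin k → Vec n) → Set
LinIndep p {n} {k} v = ∀ (c : Fin k → ℤ) → comb v c ≈ᵥ[ p ] (λ _ → + 0) → ∀ i → c i ≈[ p ] + 0

{-# OPTIONS --safe #-}

-- Work modulo p. Self-adjointness makes each Mⱼ a symmetric bilinear form Bⱼ(x, y) = Mⱼ x · y,
-- and we induct on n; for n ≤ 2d the empty family will do. Otherwise the d quadratic forms
-- Bⱼ(x, x) have total degree 2d < n, so by Chevalley's theorem they have a common zero x ≠ 0,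
-- say with xᵢ ≠ 0. The d + 1 linear conditions yᵢ = 0 and Bⱼ(x, y) = 0 leave n − d − 1
-- independent solutions (Gaussian elimination). By induction the forms restricted to their span
-- have a large independent isotropic family w′, and x followed by w′ is again isotropic,
-- independent (read off coordinate i) and one longer, which pays for the d + 1 lost dimensions.
--
-- Chevalley's theorem: if the Qⱼ had no common zero but the origin, then by Fermat the polynomial
-- ∏ⱼ (1 − Qⱼ^(p−1)) would be the indicator of the origin, so its sum over 𝔽ₚⁿ would be 1. But
-- its degree is below n(p − 1), so each of its monomials sums to a product of power sums ∑ₜ tᵉ
-- one of which has e < p − 1 and hence vanishes (by Newton's recurrence, obtained by expanding
-- the telescoping sum ∑ₜ ((1 + t)^(e+1) − t^(e+1)) = p^(e+1)).

module Submission where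

open import Data.Nat.Base using (ℕ)
open import Data.Nat.Primality using (Prime)

module Modular (p : ℕ) where

  open import Algebra.Bundles using (CommutativeRing)
  open import Data.Integer.Base using (ℤ; +_; _+_; _*_; _-_; -_; _^_; 0ℤ; 1ℤ)
  import Data.Integer.Properties as ℤ
  open import Data.Integer.Divisibility.Signed
    using (_∣_; divides; _∣?_; ∣m∣n⇒∣m+n; ∣m⇒∣-m; ∣m⇒∣m*n; ∣n⇒∣m*n; ∣ᵤ⇒∣; ∣⇒∣ᵤ)
  open import Data.Integer.Tactic.RingSolver using (solve-∀)
  open import Data.Nat.Base using (zero; suc)
  open import Data.Product.Base using (_,_)
  open import Level using (0ℓ)
  open import Relation.Binary.Definitions using (Decidable)
  open import Relation.Binary.PropositionalEquality using (_≡_; refl; sym; trans; subst)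
  import Relation.Nullary.Decidable as Dec
  open import Defs using (_≈[_]_)

  -- A record rather than a synonym for p ∣ a - b, so that Agda can infer a and b from a ≈ b.
  infix 4 _≈_
  record _≈_ (a b : ℤ) : Set where
    constructor congruent
    field p∣a-b : + p ∣ a - b

  private
    via : ∀ {x} c d → x ≡ c - d → + p ∣ x → c ≈ d
    via c d eq p∣x = congruent (subst (+ p ∣_) eq p∣x)

  ≡⇒≈ : ∀ {a b} → a ≡ b → a ≈ b
  ≡⇒≈ {a} refl = congruent (divides 0ℤ (ℤ.+-inverseʳ a))

  ≈-refl : ∀ {a} → a ≈ a
  ≈-refl = ≡⇒≈ refl

  ≈-sym : ∀ {a b} → a ≈ b → b ≈ a
  ≈-sym {a} {b} (congruent h) = via b a (lemma a b) (∣m⇒∣-m h)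
    where
    lemma : ∀ a b → - (a - b) ≡ b - a
    lemma = solve-∀

  ≈-trans : ∀ {a b c} → a ≈ b → b ≈ c → a ≈ c
  ≈-trans {a} {b} {c} (congruent h) (congruent k) = via a c (ℤ.+-minus-telescope a b c) (∣m∣n⇒∣m+n h k)

  private
    +-cong : ∀ {a a′ b b′} → a ≈ a′ → b ≈ b′ → a + b ≈ a′ + b′
    +-cong {a} {a′} {b} {b′} (congruent h) (congruent k) = via (a + b) (a′ + b′) (lemma a a′ b b′) (∣m∣n⇒∣m+n h k)
      where
      lemma : ∀ a a′ b b′ → a - a′ + (b - b′) ≡ a + b - (a′ + b′)
      lemma = solve-∀

    *-cong : ∀ {a a′ b b′} → a ≈ a′ → b ≈ b′ → a * b ≈ a′ * b′
    *-cong {a} {a′} {b} {b′} (congruent h) (congruent k) =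
      via (a * b) (a′ * b′) (lemma a a′ b b′) (∣m∣n⇒∣m+n (∣n⇒∣m*n a k) (∣m⇒∣m*n b′ h))
      where
      lemma : ∀ a a′ b b′ → a * (b - b′) + (a - a′) * b′ ≡ a * b - a′ * b′
      lemma = solve-∀

    -‿cong : ∀ {a b} → a ≈ b → - a ≈ - b
    -‿cong {a} {b} (congruent h) = via (- a) (- b) (lemma a b) (∣m⇒∣-m h)
      where
      lemma : ∀ a b → - (a - b) ≡ - a - - b
      lemma = solve-∀

  ℤ/p : CommutativeRing 0ℓ 0ℓ
  ℤ/p = record
    { isCommutativeRing = record
      { isRing = record
        { +-isAbelianGroup = record
          { isGroup = record
            { isMonoid = record
              { isSemigroup = record
                { isMagma = record
                  { isEquivalence = record { refl = ≈-refl ; sym = ≈-sym ; trans = ≈-trans }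
                  ; ∙-cong        = +-cong
                  }
                ; assoc = λ a b c → ≡⇒≈ (ℤ.+-assoc a b c)
                }
              ; identity = (λ a → ≡⇒≈ (ℤ.+-identityˡ a)) , (λ a → ≡⇒≈ (ℤ.+-identityʳ a))
              }
            ; inverse = (λ a → ≡⇒≈ (ℤ.+-inverseˡ a)) , (λ a → ≡⇒≈ (ℤ.+-inverseʳ a))
            ; ⁻¹-cong = -‿cong
            }
          ; comm = λ a b → ≡⇒≈ (ℤ.+-comm a b)
          }
        ; *-cong     = *-cong
        ; *-assoc    = λ a b c → ≡⇒≈ (ℤ.*-assoc a b c)
        ; *-identity = (λ a → ≡⇒≈ (ℤ.*-identityˡ a)) , (λ a → ≡⇒≈ (ℤ.*-identityʳ a))
        ; distrib    = (λ a b c → ≡⇒≈ (ℤ.*-distribˡ-+ a b c)) , (λ a b c → ≡⇒≈ (ℤ.*-distribʳ-+ a b c))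
        }
      ; *-comm = λ a b → ≡⇒≈ (ℤ.*-comm a b)
      }
    }

  _≈?_ : Decidable _≈_
  a ≈? b = Dec.map′ congruent _≈_.p∣a-b (+ p ∣? (a - b))

  p≈0 : + p ≈ 0ℤ
  p≈0 = congruent (divides 1ℤ (trans (ℤ.+-identityʳ (+ p)) (sym (ℤ.*-identityˡ (+ p)))))

  ^-cong : ∀ {a b} n → a ≈ b → a ^ n ≈ b ^ n
  ^-cong zero    a≈b = ≈-refl
  ^-cong (suc n) a≈b = *-cong a≈b (^-cong n a≈b)

  a≈b⇒a-b≈0 : ∀ {a b} → a ≈ b → a - b ≈ 0ℤ
  a≈b⇒a-b≈0 {a} {b} (congruent h) = via (a - b) 0ℤ (sym (ℤ.+-identityʳ (a - b))) h

  a-b≈0⇒a≈b : ∀ {a b} → a - b ≈ 0ℤ → a ≈ b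
  a-b≈0⇒a≈b {a} {b} (congruent h) = via a b (ℤ.+-identityʳ (a - b)) h

  ≈[]⇒≈ : ∀ {a b} → a ≈[ p ] b → a ≈ b
  ≈[]⇒≈ a≈b = congruent (∣ᵤ⇒∣ a≈b)

  ≈⇒≈[] : ∀ {a b} → a ≈ b → a ≈[ p ] b
  ≈⇒≈[] (congruent h) = ∣⇒∣ᵤ h

module Sums (p : ℕ) where

  open import Algebra.Bundles using (CommutativeRing)
  open import Data.Fin.Base using (Fin; zero; suc; toℕ; punchIn)
  open import Data.Fin.Properties using (toℕ-fromℕ; toℕ-inject₁; punchInᵢ≢i)
  open import Data.Integer.Base using (ℤ; _+_; _*_; _-_; 0ℤ)
  import Data.Integer.Properties as ℤ
  open import Data.Nat.Base using (zero; suc)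
  open import Data.Vec.Functional using (removeAt; init; last)
  open import Function.Base using (_∘_)
  open import Relation.Binary.PropositionalEquality using (_≡_; _≢_; refl; sym; trans; cong; cong₂)
  open import Defs using (∑)
  open Modular p

  open CommutativeRing ℤ/p using (setoid; semiring; +-cong; +-congˡ)
  import Algebra.Properties.Semiring.Sum semiring as Sum
  open import Relation.Binary.Reasoning.Setoid setoid

  ∑≡sum : ∀ {n} (f : Fin n → ℤ) → ∑ f ≡ Sum.sum f
  ∑≡sum {zero}  f = refl
  ∑≡sum {suc n} f = cong (f zero +_) (∑≡sum (f ∘ suc))

  ∑-cong : ∀ {n} {f g : Fin n → ℤ} → (∀ i → f i ≈ g i) → ∑ f ≈ ∑ g
  ∑-cong {f = f} {g} f≈g = begin
    ∑ f       ≡⟨ ∑≡sum f ⟩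
    Sum.sum f ≈⟨ Sum.sum-cong-≋ f≈g ⟩
    Sum.sum g ≡⟨ ∑≡sum g ⟨
    ∑ g       ∎

  ∑≈0 : ∀ {n} {f : Fin n → ℤ} → (∀ i → f i ≈ 0ℤ) → ∑ f ≈ 0ℤ
  ∑≈0 {n} f≈0 = ≈-trans (∑-cong f≈0) (≈-trans (≡⇒≈ (∑≡sum {n} (λ _ → 0ℤ))) (Sum.sum-replicate-zero n))

  ∑-distrib-+ : ∀ {n} (f g : Fin n → ℤ) → ∑ (λ i → f i + g i) ≈ ∑ f + ∑ g
  ∑-distrib-+ f g = begin
    ∑ (λ i → f i + g i)       ≡⟨ ∑≡sum (λ i → f i + g i) ⟩
    Sum.sum (λ i → f i + g i) ≈⟨ Sum.∑-distrib-+ f g ⟩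
    Sum.sum f + Sum.sum g     ≡⟨ cong₂ _+_ (∑≡sum f) (∑≡sum g) ⟨
    ∑ f + ∑ g                 ∎

  *-distribˡ-∑ : ∀ {n} c (f : Fin n → ℤ) → c * ∑ f ≈ ∑ (λ i → c * f i)
  *-distribˡ-∑ c f = begin
    c * ∑ f                 ≡⟨ cong (c *_) (∑≡sum f) ⟩
    c * Sum.sum f           ≈⟨ Sum.*-distribˡ-sum c f ⟩
    Sum.sum (λ i → c * f i) ≡⟨ ∑≡sum (λ i → c * f i) ⟨
    ∑ (λ i → c * f i)       ∎

  *-distribʳ-∑ : ∀ {n} c (f : Fin n → ℤ) → ∑ f * c ≈ ∑ (λ i → f i * c)
  *-distribʳ-∑ c f = begin
    ∑ f * c                 ≡⟨ cong (_* c) (∑≡sum f) ⟩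
    Sum.sum f * c           ≈⟨ Sum.*-distribʳ-sum c f ⟩
    Sum.sum (λ i → f i * c) ≡⟨ ∑≡sum (λ i → f i * c) ⟨
    ∑ (λ i → f i * c)       ∎

  ∑-comm : ∀ {m n} (f : Fin m → Fin n → ℤ) → ∑ (λ i → ∑ (f i)) ≈ ∑ (λ j → ∑ (λ i → f i j))
  ∑-comm f = begin
    ∑ (λ i → ∑ (f i))                     ≈⟨ ∑-cong (λ i → ≡⇒≈ (∑≡sum (f i))) ⟩
    ∑ (λ i → Sum.sum (f i))               ≡⟨ ∑≡sum (λ i → Sum.sum (f i)) ⟩
    Sum.sum (λ i → Sum.sum (f i))         ≈⟨ Sum.∑-comm f ⟩
    Sum.sum (λ j → Sum.sum (λ i → f i j)) ≡⟨ ∑≡sum (λ j → Sum.sum (λ i → f i j)) ⟨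
    ∑ (λ j → Sum.sum (λ i → f i j))       ≈⟨ ∑-cong (λ j → ≡⇒≈ (∑≡sum (λ i → f i j))) ⟨
    ∑ (λ j → ∑ (λ i → f i j))             ∎

  ∑-remove : ∀ {n} (f : Fin (suc n) → ℤ) i → ∑ f ≈ f i + ∑ (removeAt f i)
  ∑-remove f i = begin
    ∑ f                          ≡⟨ ∑≡sum f ⟩
    Sum.sum f                    ≈⟨ Sum.sum-remove f ⟩
    f i + Sum.sum (removeAt f i) ≡⟨ cong (f i +_) (∑≡sum (removeAt f i)) ⟨
    f i + ∑ (removeAt f i)       ∎

  ∑-single : ∀ {n} (f : Fin n → ℤ) i → (∀ j → j ≢ i → f j ≈ 0ℤ) → ∑ f ≈ f i
  ∑-single {suc n} f i others≈0 = ≈-trans (∑-remove f i)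
    (≈-trans (+-congˡ {f i} (∑≈0 (λ l → others≈0 (punchIn i l) (punchInᵢ≢i i l))))
             (≡⇒≈ (ℤ.+-identityʳ (f i))))

  ∑-init-last : ∀ {n} (f : Fin (suc n) → ℤ) → ∑ f ≈ ∑ (init f) + last f
  ∑-init-last f = begin
    ∑ f                       ≡⟨ ∑≡sum f ⟩
    Sum.sum f                 ≈⟨ Sum.sum-init-last f ⟩
    Sum.sum (init f) + last f ≡⟨ cong (_+ last f) (∑≡sum (init f)) ⟨
    ∑ (init f) + last f       ∎

  ∑-toℕ-init-last : ∀ n (f : ℕ → ℤ) → ∑ {suc n} (λ k → f (toℕ k)) ≈ ∑ {n} (λ k → f (toℕ k)) + f n
  ∑-toℕ-init-last n f = ≈-trans (∑-init-last {n} (λ k → f (toℕ k)))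
    (+-cong (∑-cong {n} (λ k → ≡⇒≈ (cong f (toℕ-inject₁ k)))) (≡⇒≈ (cong f (toℕ-fromℕ n))))

  ∑-telescope : ∀ n (g : ℕ → ℤ) → ∑ {n} (λ t → g (suc (toℕ t)) - g (toℕ t)) ≡ g n - g 0
  ∑-telescope zero    g = sym (ℤ.+-inverseʳ (g 0))
  ∑-telescope (suc n) g = trans (cong (_+_ (g 1 - g 0)) (∑-telescope n (g ∘ suc)))
    (trans (ℤ.+-comm (g 1 - g 0) (g (suc n) - g 1)) (ℤ.+-minus-telescope (g (suc n)) (g 1) (g 0)))

module BinomialTheorem (p : ℕ) where

  open import Algebra.Bundles using (CommutativeRing)
  open import Data.Fin.Base using (toℕ)
  open import Data.Fin.Properties using (toℕ<n)
  open import Data.Integer.Base using (ℤ; +_; _+_; _*_; _-_; -_; _^_; 0ℤ; 1ℤ)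
  import Data.Integer.Properties as ℤ
  open import Data.Integer.Tactic.RingSolver using (solve-∀)
  open import Data.Nat.Base as ℕ using (zero; suc; _∸_; z≤n; s≤s)
  open import Data.Nat.Combinatorics using (_C_; nCn≡1)
  open import Relation.Binary.PropositionalEquality using (_≡_; refl; sym; trans; cong; cong₂)
  open import Defs using (∑)
  open Modular p
  open Sums p

  open CommutativeRing ℤ/p using (commutativeSemiring; semiring; setoid; +-congˡ; +-congʳ; *-congʳ; zeroˡ)
  import Algebra.Properties.CommutativeSemiring.Binomial commutativeSemiring as Binomial
  import Algebra.Properties.Semiring.Exp semiring as Exp
  import Algebra.Properties.Semiring.Mult semiring as Mult
  open import Relation.Binary.Reasoning.Setoid setoid

  private
    ^-agrees : ∀ x n → x Exp.^ n ≡ x ^ n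
    ^-agrees x zero    = refl
    ^-agrees x (suc n) = cong (x *_) (^-agrees x n)

    ×-agrees : ∀ n x → n Mult.× x ≡ + n * x
    ×-agrees zero    x = sym (ℤ.*-zeroˡ x)
    ×-agrees (suc n) x = trans (cong (_+_ x) (×-agrees n x)) (sym (ℤ.suc-* (+ n) x))

  binomial : ∀ n x → (1ℤ + x) ^ n ≈ ∑ {suc n} (λ k → + (n C toℕ k) * x ^ toℕ k)
  binomial n x = begin
    (1ℤ + x) ^ n                                ≡⟨ cong (_^ n) (ℤ.+-comm 1ℤ x) ⟩
    (x + 1ℤ) ^ n                                ≡⟨ ^-agrees (x + 1ℤ) n ⟨
    (x + 1ℤ) Exp.^ n                            ≈⟨ Binomial.theorem n x 1ℤ ⟩
    Binomial.binomialExpansion x 1ℤ n           ≡⟨ ∑≡sum (Binomial.binomialTerm x 1ℤ n) ⟨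
    ∑ (Binomial.binomialTerm x 1ℤ n)            ≈⟨ ∑-cong {suc n} (λ k → ≡⇒≈ (term (toℕ k))) ⟩
    ∑ {suc n} (λ k → + (n C toℕ k) * x ^ toℕ k) ∎
    where
    term : ∀ k → (n C k) Mult.× (x Exp.^ k * 1ℤ Exp.^ (n ∸ k)) ≡ + (n C k) * x ^ k
    term k = trans (×-agrees (n C k) _) (cong (+ (n C k) *_) (trans
      (cong₂ _*_ (^-agrees x k) (trans (^-agrees 1ℤ (n ∸ k)) (ℤ.^-zeroˡ (n ∸ k))))
      (ℤ.*-identityʳ (x ^ k))))

  binomial-last : ∀ n x → (1ℤ + x) ^ n ≈ ∑ {n} (λ k → + (n C toℕ k) * x ^ toℕ k) + x ^ n
  binomial-last n x = ≈-trans (binomial n x)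
    (≈-trans (∑-toℕ-init-last n term) (+-congˡ {∑ {n} (λ k → term (toℕ k))} (≡⇒≈ top)))
    where
    term : ℕ → ℤ
    term k = + (n C k) * x ^ k
    top : term n ≡ x ^ n
    top = trans (cong (λ c → + c * x ^ n) (nCn≡1 n)) (ℤ.*-identityˡ (x ^ n))

  binomial-difference : ∀ n x → (1ℤ + x) ^ n - x ^ n ≈ ∑ {n} (λ k → + (n C toℕ k) * x ^ toℕ k)
  binomial-difference n x = ≈-trans (+-congʳ { - (x ^ n)} (binomial-last n x)) (≡⇒≈ (lemma _ (x ^ n)))
    where
    lemma : ∀ a b → a + b - b ≡ a
    lemma = solve-∀

  binomial-ends : ∀ {n} → 0 ℕ.< n → ∀ x → (∀ k → 0 ℕ.< k → k ℕ.< n → + (n C k) ≈ 0ℤ) →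
                  (1ℤ + x) ^ n ≈ 1ℤ + x ^ n
  binomial-ends {suc q} (s≤s z≤n) x middle≈0 = begin
    (1ℤ + x) ^ suc q
      ≈⟨ binomial-last (suc q) x ⟩
    1ℤ + ∑ {q} (λ k → + (suc q C suc (toℕ k)) * x ^ suc (toℕ k)) + x ^ suc q
      ≈⟨ +-congʳ {x ^ suc q} (+-congˡ {1ℤ} (∑≈0 middle)) ⟩
    1ℤ + x ^ suc q
      ∎
    where
    middle : ∀ k → + (suc q C suc (toℕ k)) * x ^ suc (toℕ k) ≈ 0ℤ
    middle k = ≈-trans (*-congʳ (middle≈0 (suc (toℕ k)) (s≤s z≤n) (s≤s (toℕ<n k)))) (zeroˡ (x ^ suc (toℕ k)))

module PrimeField (p : ℕ) (p-prime : Prime p) where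

  open import Algebra.Bundles using (CommutativeRing)
  open import Data.Fin.Base using (Fin; toℕ)
  open import Data.Fin.Properties using (toℕ<n)
  open import Data.Integer.Base using (ℤ; +_; _+_; _*_; _-_; -_; _^_; 0ℤ; 1ℤ; ∣_∣; _%ℕ_; _/ℕ_)
  import Data.Integer.Properties as ℤ
  open import Data.Integer.DivMod using (a≡a%ℕn+[a/ℕn]*n)
  open import Data.Integer.Divisibility.Signed using (∣ᵤ⇒∣; ∣⇒∣ᵤ)
  open import Data.Integer.Tactic.RingSolver using (solve-∀)
  open import Data.Nat.Base as ℕ using (zero; suc; _∸_; _!; z≤n; s≤s)
  import Data.Nat.Properties as ℕ
  open import Data.Nat.Combinatorics using (_C_; k![n∸k]!∣n!; nCk≡nC[n∸k]; nC1≡n)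
  open import Data.Nat.Combinatorics.Specification using (nCk≡n!/k![n-k]!)
  open import Data.Nat.Divisibility using (_∣_; ∣⇒≤; ∣1⇒≡1; m∣m*n; m∣n⇒n≡quotient*m; n/m≡quotient)
  open import Data.Nat.Induction using (<-rec)
  open import Data.Nat.Primality using (euclidsLemma; prime⇒nonZero; prime⇒nonTrivial)
  open import Data.Product.Base using (Σ; _,_)
  open import Data.Sum.Base using (_⊎_; [_,_]′)
  import Data.Sum.Base as Sum
  open import Function.Base using (id)
  open import Relation.Nullary.Negation using (¬_; contradiction)
  open import Relation.Binary.PropositionalEquality using (_≡_; sym; trans; cong; subst)
  open import Defs using (∑)
  open Modular p
  open Sums p
  open BinomialTheorem p

  open CommutativeRing ℤ/p using (setoid; -‿cong; +-congˡ; +-congʳ; *-congˡ; *-congʳ; zeroˡ; zeroʳ; +-identityˡ)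
  open import Relation.Binary.Reasoning.Setoid setoid

  private
    instance
      p-nonZero    = prime⇒nonZero p-prime
      p-nonTrivial = prime⇒nonTrivial p-prime

    1<p : 1 ℕ.< p
    1<p = ℕ.nonTrivial⇒n>1 p

    0<p∸1 : 0 ℕ.< p ∸ 1
    0<p∸1 = ℕ.∸-monoˡ-< {1} {1} {p} 1<p ℕ.≤-refl

    0^n≈0 : ∀ {n} → 0 ℕ.< n → 0ℤ ^ n ≈ 0ℤ
    0^n≈0 {suc n} _ = ≈-refl

  ≈0⇒p∣ : ∀ {a} → a ≈ 0ℤ → p ∣ ∣ a ∣
  ≈0⇒p∣ {a} (congruent h) = subst (λ z → p ∣ ∣ z ∣) (ℤ.+-identityʳ a) (∣⇒∣ᵤ h)

  p∣⇒≈0 : ∀ {a} → p ∣ ∣ a ∣ → a ≈ 0ℤ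
  p∣⇒≈0 {a} p∣a = congruent (∣ᵤ⇒∣ (subst (λ z → p ∣ ∣ z ∣) (sym (ℤ.+-identityʳ a)) p∣a))

  *≈0⇒≈0∨≈0 : ∀ a b → a * b ≈ 0ℤ → a ≈ 0ℤ ⊎ b ≈ 0ℤ
  *≈0⇒≈0∨≈0 a b ab≈0 =
    Sum.map p∣⇒≈0 p∣⇒≈0 (euclidsLemma ∣ a ∣ ∣ b ∣ p-prime (subst (p ∣_) (ℤ.abs-* a b) (≈0⇒p∣ ab≈0)))

  *-cancelˡ-≈0 : ∀ {a b} → ¬ a ≈ 0ℤ → a * b ≈ 0ℤ → b ≈ 0ℤ
  *-cancelˡ-≈0 {a} {b} a≉0 ab≈0 = [ (λ a≈0 → contradiction a≈0 a≉0) , id ]′ (*≈0⇒≈0∨≈0 a b ab≈0)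

  0<n<p⇒n≉0 : ∀ {n} → 0 ℕ.< n → n ℕ.< p → ¬ + n ≈ 0ℤ
  0<n<p⇒n≉0 0<n n<p n≈0 = ℕ.<⇒≱ n<p (∣⇒≤ {{ℕ.>-nonZero 0<n}} (≈0⇒p∣ n≈0))

  1≉0 : ¬ 1ℤ ≈ 0ℤ
  1≉0 = 0<n<p⇒n≉0 (s≤s z≤n) 1<p

  private
    n!≡nCk*[k!*[n∸k]!] : ∀ {n k} → k ℕ.≤ n → n ! ≡ (n C k) ℕ.* (k ! ℕ.* (n ∸ k) !)
    n!≡nCk*[k!*[n∸k]!] {n} {k} k≤n = trans (m∣n⇒n≡quotient*m (k![n∸k]!∣n! k≤n))
      (cong (ℕ._* (k ! ℕ.* (n ∸ k) !))
            (sym (trans (nCk≡n!/k![n-k]! k≤n) (n/m≡quotient (k![n∸k]!∣n! k≤n) {{k ℕ.!* (n ∸ k) !≢0}}))))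

    n∣n! : ∀ {n} → 0 ℕ.< n → n ∣ n !
    n∣n! {suc n} _ = m∣m*n (n !)

  p∤n! : ∀ {n} → n ℕ.< p → ¬ p ∣ n !
  p∤n! {zero}  _   p∣1  = ℕ.<⇒≢ 1<p (sym (∣1⇒≡1 p∣1))
  p∤n! {suc n} n<p p∣n! = [ (λ p∣n → ℕ.<⇒≱ n<p (∣⇒≤ p∣n)) , p∤n! (ℕ.<-trans (ℕ.n<1+n n) n<p) ]′
                            (euclidsLemma (suc n) (n !) p-prime p∣n!)

  p∣pCk : ∀ {k} → 0 ℕ.< k → k ℕ.< p → p ∣ p C k
  p∣pCk {k} 0<k k<p = [ id , (λ p∣k![p∸k]! → contradiction p∣k![p∸k]! p∤k![p∸k]!) ]′
                        (euclidsLemma (p C k) (k ! ℕ.* (p ∸ k) !) p-prime p∣p!)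
    where
    p∣p! : p ∣ (p C k) ℕ.* (k ! ℕ.* (p ∸ k) !)
    p∣p! = subst (p ∣_) (n!≡nCk*[k!*[n∸k]!] (ℕ.<⇒≤ k<p)) (n∣n! (ℕ.<-trans (s≤s z≤n) 1<p))
    p∤k![p∸k]! : ¬ p ∣ k ! ℕ.* (p ∸ k) !
    p∤k![p∸k]! p∣ = [ p∤n! k<p , p∤n! (ℕ.∸-monoʳ-< {p} {k} {0} 0<k (ℕ.<⇒≤ k<p)) ]′
                      (euclidsLemma (k !) ((p ∸ k) !) p-prime p∣)

  frobenius : ∀ x → (1ℤ + x) ^ p ≈ 1ℤ + x ^ p
  frobenius x = binomial-ends (ℕ.<-trans (s≤s z≤n) 1<p) x (λ k 0<k k<p → p∣⇒≈0 (p∣pCk 0<k k<p))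

  fermat : ∀ x → x ^ p ≈ x
  fermat x = begin
    x ^ p      ≈⟨ ^-cong p x≈r ⟩
    (+ r) ^ p  ≈⟨ fermatℕ r ⟩
    + r        ≈⟨ ≈-sym x≈r ⟩
    x          ∎
    where
    r = x %ℕ p
    x≈r : x ≈ + r
    x≈r = begin
      x                    ≡⟨ a≡a%ℕn+[a/ℕn]*n x p ⟩
      + r + (x /ℕ p) * + p ≈⟨ +-congˡ {+ r} (≈-trans (*-congˡ {x /ℕ p} p≈0) (zeroʳ (x /ℕ p))) ⟩
      + r + 0ℤ             ≡⟨ ℤ.+-identityʳ (+ r) ⟩
      + r                  ∎
    fermatℕ : ∀ n → (+ n) ^ p ≈ + n
    fermatℕ zero    = 0^n≈0 (ℕ.<-trans (s≤s z≤n) 1<p)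
    fermatℕ (suc n) = ≈-trans (frobenius (+ n)) (+-congˡ {1ℤ} (fermatℕ n))

  fermat-≉0 : ∀ {x} → ¬ x ≈ 0ℤ → x ^ (p ∸ 1) ≈ 1ℤ
  fermat-≉0 {x} x≉0 = a-b≈0⇒a≈b (*-cancelˡ-≈0 x≉0 (begin
    x * (x ^ (p ∸ 1) - 1ℤ) ≡⟨ lemma x (x ^ (p ∸ 1)) ⟩
    x ^ suc (p ∸ 1) - x    ≡⟨ cong (λ n → x ^ n - x) (ℕ.m+[n∸m]≡n (ℕ.<⇒≤ 1<p)) ⟩
    x ^ p - x              ≈⟨ a≈b⇒a-b≈0 (fermat x) ⟩
    0ℤ                     ∎))
    where
    lemma : ∀ x y → x * (y - 1ℤ) ≡ x * y - x
    lemma = solve-∀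

  1-x^[p-1]≈0 : ∀ {x} → ¬ x ≈ 0ℤ → 1ℤ - x ^ (p ∸ 1) ≈ 0ℤ
  1-x^[p-1]≈0 x≉0 = a≈b⇒a-b≈0 (≈-sym (fermat-≉0 x≉0))

  1-x^[p-1]≈1 : ∀ {x} → x ≈ 0ℤ → 1ℤ - x ^ (p ∸ 1) ≈ 1ℤ
  1-x^[p-1]≈1 x≈0 = +-congˡ {1ℤ} (-‿cong (≈-trans (^-cong (p ∸ 1) x≈0) (0^n≈0 0<p∸1)))

  inverse : ∀ {x} → ¬ x ≈ 0ℤ → Σ ℤ (λ y → x * y ≈ 1ℤ)
  inverse {x} x≉0 = x ^ (p ∸ 2) , ≈-trans (≡⇒≈ (cong (x ^_) (sym (ℕ.+-∸-assoc 1 1<p)))) (fermat-≉0 x≉0)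

  powerSum : ℕ → ℤ
  powerSum e = ∑ {p} (λ t → (+ toℕ t) ^ e)

  powerSum-recurrence : ∀ e → ∑ {suc e} (λ k → + (suc e C toℕ k) * powerSum (toℕ k)) ≈ 0ℤ
  powerSum-recurrence e = begin
    ∑ {suc e} (λ k → c k * powerSum (toℕ k))
      ≈⟨ ∑-cong {suc e} (λ k → *-distribˡ-∑ {p} (c k) (λ t → power t (toℕ k))) ⟩
    ∑ {suc e} (λ k → ∑ {p} (λ t → c k * power t (toℕ k)))
      ≈⟨ ∑-comm {suc e} {p} (λ k t → c k * power t (toℕ k)) ⟩
    ∑ {p} (λ t → ∑ {suc e} (λ k → c k * power t (toℕ k)))
      ≈⟨ ∑-cong {p} (λ t → ≈-sym (binomial-difference (suc e) (+ toℕ t))) ⟩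
    ∑ {p} (λ t → (+ suc (toℕ t)) ^ suc e - (+ toℕ t) ^ suc e)
      ≡⟨ ∑-telescope p (λ n → (+ n) ^ suc e) ⟩
    + p * (+ p) ^ e - 0ℤ
      ≈⟨ +-congʳ { - 0ℤ} (≈-trans (*-congʳ p≈0) (zeroˡ ((+ p) ^ e))) ⟩
    0ℤ
      ∎
    where
    c : Fin (suc e) → ℤ
    c k = + (suc e C toℕ k)
    power : Fin p → ℕ → ℤ
    power t k = (+ toℕ t) ^ k

  powerSum≈0 : ∀ e → suc e ℕ.< p → powerSum e ≈ 0ℤ
  powerSum≈0 = <-rec (λ e → suc e ℕ.< p → powerSum e ≈ 0ℤ) step
    where
    step : ∀ e → (∀ {k} → k ℕ.< e → suc k ℕ.< p → powerSum k ≈ 0ℤ) → suc e ℕ.< p → powerSum e ≈ 0ℤ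
    step e below 1+e<p = *-cancelˡ-≈0 (0<n<p⇒n≉0 (s≤s z≤n) 1+e<p) (begin
      + suc e * powerSum e                ≡⟨ cong (λ c → + c * powerSum e) (sym 1+eCe≡1+e) ⟩
      term e                              ≈⟨ +-identityˡ (term e) ⟨
      0ℤ + term e                         ≈⟨ +-congʳ {term e} (∑≈0 lower) ⟨
      ∑ {e} (λ k → term (toℕ k)) + term e ≈⟨ ∑-toℕ-init-last e term ⟨
      ∑ {suc e} (λ k → term (toℕ k))      ≈⟨ powerSum-recurrence e ⟩
      0ℤ                                  ∎)
      where
      term : ℕ → ℤ
      term k = + (suc e C k) * powerSum k
      1+eCe≡1+e : suc e C e ≡ suc e
      1+eCe≡1+e = trans (nCk≡nC[n∸k] (ℕ.n≤1+n e)) (trans (cong (suc e C_) (ℕ.m+n∸n≡m 1 e)) (nC1≡n (suc e)))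
      lower : ∀ (k : Fin e) → term (toℕ k) ≈ 0ℤ
      lower k = ≈-trans (*-congˡ {+ (suc e C toℕ k)} (below (toℕ<n k) (ℕ.<-trans (s≤s (toℕ<n k)) 1+e<p)))
                        (zeroʳ (+ (suc e C toℕ k)))

module Polynomials (p : ℕ) where

  open import Algebra.Bundles using (CommutativeRing)
  open import Data.Fin.Base using (Fin; zero; suc)
  open import Data.Integer.Base using (ℤ; _+_; _*_; _^_; 0ℤ; 1ℤ)
  import Data.Integer.Properties as ℤ
  open import Data.Integer.Tactic.RingSolver using (solve-∀)
  open import Data.Nat.Base as ℕ using (zero; suc; z≤n)
  import Data.Nat.Properties as ℕ
  open import Data.Vec.Functional using (_∷_; removeAt)
  open import Relation.Binary.PropositionalEquality using (_≡_; sym; cong; subst)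
  open import Defs using (Vec; ∑)
  open Modular p

  open CommutativeRing ℤ/p using (setoid; *-commutativeMonoid; +-cong; +-congʳ; *-cong; *-congˡ; *-congʳ;
    +-identityˡ; +-identityʳ; +-assoc; *-identityʳ; zeroˡ; zeroʳ; distribʳ)
  open import Relation.Binary.Reasoning.Setoid setoid
  import Algebra.Properties.CommutativeMonoid.Sum *-commutativeMonoid as Product
  import Algebra.Properties.CommutativeMonoid.Sum ℕ.+-0-commutativeMonoid as ℕSum

  ∏ : ∀ {n} → (Fin n → ℤ) → ℤ
  ∏ = Product.sum

  ∏≈1 : ∀ {n} {f : Fin n → ℤ} → (∀ i → f i ≈ 1ℤ) → ∏ f ≈ 1ℤ
  ∏≈1 {n} f≈1 = ≈-trans (Product.sum-cong-≋ f≈1) (Product.sum-replicate-zero n)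

  ∏≈0 : ∀ {n} (f : Fin n → ℤ) i → f i ≈ 0ℤ → ∏ f ≈ 0ℤ
  ∏≈0 {suc n} f i fᵢ≈0 =
    ≈-trans (Product.sum-remove {i = i} f) (≈-trans (*-congʳ fᵢ≈0) (zeroˡ (∏ (removeAt f i))))

  Exponents : ℕ → Set
  Exponents m = Fin m → ℕ

  degree : ∀ {m} → Exponents m → ℕ
  degree = ℕSum.sum

  monomial : ∀ {m} → Exponents m → Vec m → ℤ
  monomial α x = ∏ (λ i → x i ^ α i)

  unit : ∀ {m} → Fin m → Exponents m
  unit zero    = 1 ∷ (λ _ → 0)
  unit (suc i) = 0 ∷ unit i

  degree-+ : ∀ {m} (α β : Exponents m) → degree (λ i → α i ℕ.+ β i) ≡ degree α ℕ.+ degree β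
  degree-+ = ℕSum.∑-distrib-+

  degree-zero : ∀ m → degree {m} (λ _ → 0) ≡ 0
  degree-zero = ℕSum.sum-replicate-zero

  degree-unit : ∀ {m} (i : Fin m) → degree (unit i) ≡ 1
  degree-unit {suc m} zero    = cong suc (degree-zero m)
  degree-unit {suc m} (suc i) = degree-unit i

  monomial-cong : ∀ {m} (α : Exponents m) {x y : Vec m} → (∀ i → x i ≈ y i) → monomial α x ≈ monomial α y
  monomial-cong α x≈y = Product.sum-cong-≋ (λ i → ^-cong (α i) (x≈y i))

  monomial-+ : ∀ {m} (α β : Exponents m) x → monomial (λ i → α i ℕ.+ β i) x ≈ monomial α x * monomial β x
  monomial-+ α β x = ≈-trans (Product.sum-cong-≋ (λ i → ≡⇒≈ (ℤ.^-distribˡ-+-* (x i) (α i) (β i))))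
    (Product.∑-distrib-+ (λ i → x i ^ α i) (λ i → x i ^ β i))

  monomial-zero : ∀ {m} (x : Vec m) → monomial (λ _ → 0) x ≈ 1ℤ
  monomial-zero {m} x = Product.sum-replicate-zero m

  monomial-unit : ∀ {m} (i : Fin m) x → monomial (unit i) x ≈ x i
  monomial-unit {suc m} zero x = begin
    x zero ^ 1 * monomial (λ _ → 0) (λ i → x (suc i))
      ≈⟨ *-cong (≡⇒≈ (ℤ.^-identityʳ (x zero))) (monomial-zero (λ i → x (suc i))) ⟩
    x zero * 1ℤ
      ≈⟨ *-identityʳ (x zero) ⟩
    x zero
      ∎
  monomial-unit {suc m} (suc i) x = ≈-trans (≡⇒≈ (ℤ.*-identityˡ _)) (monomial-unit i (λ j → x (suc j)))

  data Polynomial≤ {m} (D : ℕ) : (Vec m → ℤ) → Set where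
    nil   : Polynomial≤ D (λ _ → 0ℤ)
    term+ : ∀ {f} c α → degree α ℕ.≤ D → Polynomial≤ D f → Polynomial≤ D (λ x → c * monomial α x + f x)
    resp  : ∀ {f g} → (∀ x → f x ≈ g x) → Polynomial≤ D f → Polynomial≤ D g

  polynomial-cong : ∀ {m D} {f : Vec m → ℤ} → Polynomial≤ D f → ∀ {x y} → (∀ i → x i ≈ y i) → f x ≈ f y
  polynomial-cong nil                      x≈y = ≈-refl
  polynomial-cong (term+ c α _ P)          x≈y = +-cong (*-congˡ {c} (monomial-cong α x≈y)) (polynomial-cong P x≈y)
  polynomial-cong (resp f≈g P) {x} {y} x≈y = ≈-trans (≈-sym (f≈g x)) (≈-trans (polynomial-cong P x≈y) (f≈g y))

  const-polynomial : ∀ {m D} c → Polynomial≤ {m} D (λ _ → c)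
  const-polynomial {m} {D} c = resp at (term+ c (λ _ → 0) (subst (ℕ._≤ D) (sym (degree-zero m)) z≤n) nil)
    where
    at : ∀ x → c * monomial (λ _ → 0) x + 0ℤ ≈ c
    at x = ≈-trans (+-identityʳ _) (≈-trans (*-congˡ {c} (monomial-zero x)) (*-identityʳ c))

  var-polynomial : ∀ {m} (i : Fin m) → Polynomial≤ 1 (λ x → x i)
  var-polynomial i = resp at (term+ 1ℤ (unit i) (ℕ.≤-reflexive (degree-unit i)) nil)
    where
    at : ∀ x → 1ℤ * monomial (unit i) x + 0ℤ ≈ x i
    at x = ≈-trans (+-identityʳ _) (≈-trans (≡⇒≈ (ℤ.*-identityˡ _)) (monomial-unit i x))

  +-polynomial : ∀ {m D} {f g : Vec m → ℤ} → Polynomial≤ D f → Polynomial≤ D g → Polynomial≤ D (λ x → f x + g x)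
  +-polynomial {g = g} nil Q = resp (λ x → ≈-sym (+-identityˡ (g x))) Q
  +-polynomial {g = g} (term+ {f} c α d P) Q =
    resp (λ x → ≈-sym (+-assoc (c * monomial α x) (f x) (g x))) (term+ c α d (+-polynomial P Q))
  +-polynomial {g = g} (resp f≈f′ P) Q = resp (λ x → +-congʳ {g x} (f≈f′ x)) (+-polynomial P Q)

  monomial*-polynomial : ∀ {m D E} {g : Vec m → ℤ} c α → degree α ℕ.≤ D → Polynomial≤ E g →
                         Polynomial≤ (D ℕ.+ E) (λ x → c * monomial α x * g x)
  monomial*-polynomial c α dα nil = resp (λ x → ≈-sym (zeroʳ (c * monomial α x))) nil
  monomial*-polynomial {D = D} {E} c α dα (term+ {g} c′ β dβ Q) =
    resp expand (term+ (c * c′) (λ i → α i ℕ.+ β i) dαβ (monomial*-polynomial c α dα Q))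
    where
    dαβ : degree (λ i → α i ℕ.+ β i) ℕ.≤ D ℕ.+ E
    dαβ = subst (ℕ._≤ D ℕ.+ E) (sym (degree-+ α β)) (ℕ.+-mono-≤ dα dβ)
    lemma : ∀ c c′ a b r → c * c′ * (a * b) + c * a * r ≡ c * a * (c′ * b + r)
    lemma = solve-∀
    expand : ∀ x → c * c′ * monomial (λ i → α i ℕ.+ β i) x + c * monomial α x * g x
                 ≈ c * monomial α x * (c′ * monomial β x + g x)
    expand x = ≈-trans (+-congʳ (*-congˡ {c * c′} (monomial-+ α β x)))
                       (≡⇒≈ (lemma c c′ (monomial α x) (monomial β x) (g x)))
  monomial*-polynomial c α dα (resp g≈g′ Q) =
    resp (λ x → *-congˡ {c * monomial α x} (g≈g′ x)) (monomial*-polynomial c α dα Q)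

  *-polynomial : ∀ {m D E} {f g : Vec m → ℤ} → Polynomial≤ D f → Polynomial≤ E g →
                 Polynomial≤ (D ℕ.+ E) (λ x → f x * g x)
  *-polynomial {g = g} nil Q = resp (λ x → ≈-sym (zeroˡ (g x))) nil
  *-polynomial {g = g} (term+ {f} c α dα P) Q =
    resp (λ x → ≈-sym (distribʳ (g x) (c * monomial α x) (f x)))
         (+-polynomial (monomial*-polynomial c α dα Q) (*-polynomial P Q))
  *-polynomial {g = g} (resp f≈f′ P) Q = resp (λ x → *-congʳ {g x} (f≈f′ x)) (*-polynomial P Q)

  ^-polynomial : ∀ {m D} {f : Vec m → ℤ} n → Polynomial≤ D f → Polynomial≤ (n ℕ.* D) (λ x → f x ^ n)
  ^-polynomial zero    P = const-polynomial 1ℤ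
  ^-polynomial (suc n) P = *-polynomial P (^-polynomial n P)

  ∑-polynomial : ∀ {m D k} {f : Fin k → Vec m → ℤ} → (∀ j → Polynomial≤ D (f j)) →
                 Polynomial≤ D (λ x → ∑ (λ j → f j x))
  ∑-polynomial {k = zero}  P = nil
  ∑-polynomial {k = suc k} P = +-polynomial (P zero) (∑-polynomial (λ j → P (suc j)))

  ∏-polynomial : ∀ {m D k} {f : Fin k → Vec m → ℤ} → (∀ j → Polynomial≤ D (f j)) →
                 Polynomial≤ (k ℕ.* D) (λ x → ∏ (λ j → f j x))
  ∏-polynomial {k = zero}  P = const-polynomial 1ℤ
  ∏-polynomial {k = suc k} P = *-polynomial (P zero) (∏-polynomial (λ j → P (suc j)))

module Chevalley (p : ℕ) (p-prime : Prime p) where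

  open import Algebra.Bundles using (CommutativeRing)
  open import Data.Fin.Base using (Fin; zero; suc; toℕ; fromℕ<)
  open import Data.Fin.Properties using (toℕ<n; toℕ-fromℕ<; toℕ-injective; any?; all?; ¬∀⟶∃¬)
  import Data.Fin.Properties as Fin
  open import Data.Integer.Base using (ℤ; +_; _+_; _*_; _-_; -_; _^_; 0ℤ; 1ℤ)
  import Data.Integer.Properties as ℤ
  open import Data.Nat.Base as ℕ using (zero; suc; _∸_; z≤n; s≤s)
  import Data.Nat.Properties as ℕ
  open import Data.Nat.Primality using (prime⇒nonTrivial)
  open import Data.Nat.Tactic.RingSolver using (solve-∀)
  open import Data.Product.Base using (Σ; _×_; _,_)
  open import Data.Vec.Base as V using ([]; _∷_)
  open import Data.Vec.Properties using (lookup-replicate)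
  open import Relation.Nullary.Decidable using (Dec; yes; no; ¬?; _×-dec_)
  import Relation.Nullary.Decidable as Dec
  open import Relation.Nullary.Negation using (¬_; contradiction)
  open import Relation.Binary.PropositionalEquality using (_≡_; _≢_; sym; trans; cong; subst)
  open import Defs using (Vec; ∑)
  open Modular p
  open Sums p
  open PrimeField p p-prime
  open Polynomials p

  open CommutativeRing ℤ/p using (setoid; +-cong; +-congʳ; *-congˡ; zeroʳ)
  open import Relation.Binary.Reasoning.Setoid setoid

  private
    instance
      p-nonTrivial = prime⇒nonTrivial p-prime

    0<p : 0 ℕ.< p
    0<p = ℕ.<-trans (s≤s z≤n) (ℕ.nonTrivial⇒n>1 p)

    0<p∸1 : 0 ℕ.< p ∸ 1
    0<p∸1 = ℕ.∸-monoˡ-< {1} {1} {p} (ℕ.nonTrivial⇒n>1 p) ℕ.≤-refl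

  -- The points of the box are inductive vectors, not functions, so that [] is the only point
  -- of Box 0 and searching the box needs no function extensionality.
  Box : ℕ → Set
  Box m = V.Vec (Fin p) m

  point : ∀ {m} → Box m → Vec m
  point u i = + toℕ (V.lookup u i)

  zeroᶠ : Fin p
  zeroᶠ = fromℕ< 0<p

  origin : ∀ {m} → Box m
  origin = V.replicate _ zeroᶠ

  Nonzero : ∀ {m} → Box m → Set
  Nonzero {m} u = Σ (Fin m) (λ i → V.lookup u i ≢ zeroᶠ)

  point-origin : ∀ {m} (i : Fin m) → point origin i ≡ 0ℤ
  point-origin i = trans (cong (λ t → + toℕ t) (lookup-replicate i zeroᶠ)) (cong +_ (toℕ-fromℕ< 0<p))

  point-≉0 : ∀ {m} (u : Box m) i → V.lookup u i ≢ zeroᶠ → ¬ point u i ≈ 0ℤ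
  point-≉0 u i uᵢ≢0 = 0<n<p⇒n≉0 (ℕ.n≢0⇒n>0 (λ eq → uᵢ≢0 (toℕ-injective (trans eq (sym (toℕ-fromℕ< 0<p))))))
                                (toℕ<n (V.lookup u i))

  search : ∀ {m} {P : Box m → Set} → (∀ u → Dec (P u)) → Dec (Σ (Box m) P)
  search {zero}  P? = Dec.map′ ([] ,_) (λ { ([] , P[]) → P[] }) (P? [])
  search {suc m} P? = Dec.map′ (λ { (t , u , Ptu) → t ∷ u , Ptu }) (λ { (t ∷ u , Ptu) → t , u , Ptu })
    (any? (λ t → search (λ u → P? (t ∷ u))))

  boxSum : ∀ {m} → (Box m → ℤ) → ℤ
  boxSum {zero}  f = f []
  boxSum {suc m} f = ∑ {p} (λ t → boxSum (λ u → f (t ∷ u)))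

  boxSum-cong : ∀ {m} {f g : Box m → ℤ} → (∀ u → f u ≈ g u) → boxSum f ≈ boxSum g
  boxSum-cong {zero}  f≈g = f≈g []
  boxSum-cong {suc m} f≈g = ∑-cong {p} (λ t → boxSum-cong (λ u → f≈g (t ∷ u)))

  boxSum≈0 : ∀ {m} {f : Box m → ℤ} → (∀ u → f u ≈ 0ℤ) → boxSum f ≈ 0ℤ
  boxSum≈0 {zero}  f≈0 = f≈0 []
  boxSum≈0 {suc m} f≈0 = ∑≈0 (λ t → boxSum≈0 (λ u → f≈0 (t ∷ u)))

  boxSum-+ : ∀ {m} (f g : Box m → ℤ) → boxSum (λ u → f u + g u) ≈ boxSum f + boxSum g
  boxSum-+ {zero}  f g = ≈-refl
  boxSum-+ {suc m} f g = ≈-trans (∑-cong {p} (λ t → boxSum-+ (λ u → f (t ∷ u)) (λ u → g (t ∷ u))))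
    (∑-distrib-+ (λ t → boxSum (λ u → f (t ∷ u))) (λ t → boxSum (λ u → g (t ∷ u))))

  boxSum-*ˡ : ∀ {m} c (f : Box m → ℤ) → boxSum (λ u → c * f u) ≈ c * boxSum f
  boxSum-*ˡ {zero}  c f = ≈-refl
  boxSum-*ˡ {suc m} c f = ≈-trans (∑-cong {p} (λ t → boxSum-*ˡ c (λ u → f (t ∷ u))))
    (≈-sym (*-distribˡ-∑ c (λ t → boxSum (λ u → f (t ∷ u)))))

  boxSum-origin : ∀ {m} (g : Box m → ℤ) → (∀ u → Nonzero u → g u ≈ 0ℤ) → boxSum g ≈ g origin
  boxSum-origin {zero}  g _   = ≈-refl
  boxSum-origin {suc m} g g≈0 = begin
    ∑ {p} (λ t → boxSum (λ u → g (t ∷ u)))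
      ≈⟨ ∑-single (λ t → boxSum (λ u → g (t ∷ u))) zeroᶠ
                  (λ t t≢0 → boxSum≈0 (λ u → g≈0 (t ∷ u) (zero , t≢0))) ⟩
    boxSum (λ u → g (zeroᶠ ∷ u))
      ≈⟨ boxSum-origin (λ u → g (zeroᶠ ∷ u)) (λ { u (i , uᵢ≢0) → g≈0 (zeroᶠ ∷ u) (suc i , uᵢ≢0) }) ⟩
    g origin
      ∎

  boxSum-monomial : ∀ {m} (α : Exponents m) → boxSum (λ u → monomial α (point u)) ≈ ∏ (λ i → powerSum (α i))
  boxSum-monomial {zero}  α = ≈-refl
  boxSum-monomial {suc m} α = begin
    ∑ {p} (λ t → boxSum (λ u → (+ toℕ t) ^ α zero * monomial α′ (point u)))
      ≈⟨ ∑-cong {p} (λ t → boxSum-*ˡ ((+ toℕ t) ^ α zero) (λ u → monomial α′ (point u))) ⟩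
    ∑ {p} (λ t → (+ toℕ t) ^ α zero * boxSum (λ u → monomial α′ (point u)))
      ≈⟨ ∑-cong {p} (λ t → *-congˡ {(+ toℕ t) ^ α zero} (boxSum-monomial α′)) ⟩
    ∑ {p} (λ t → (+ toℕ t) ^ α zero * ∏ (λ i → powerSum (α′ i)))
      ≈⟨ *-distribʳ-∑ {p} (∏ (λ i → powerSum (α′ i))) (λ t → (+ toℕ t) ^ α zero) ⟨
    powerSum (α zero) * ∏ (λ i → powerSum (α′ i))
      ∎
    where
    α′ : Exponents m
    α′ i = α (suc i)

  small-exponent : ∀ {m} (α : Exponents m) → degree α ℕ.< m ℕ.* (p ∸ 1) → Σ (Fin m) (λ i → suc (α i) ℕ.< p)
  small-exponent α small with any? (λ i → suc (α i) ℕ.<? p)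
  ... | yes found = found
  ... | no none = contradiction (large α (λ i → ℕ.∸-monoˡ-≤ 1 (ℕ.≮⇒≥ (λ lt → none (i , lt))))) (ℕ.<⇒≱ small)
    where
    large : ∀ {n} (β : Exponents n) → (∀ i → p ∸ 1 ℕ.≤ β i) → n ℕ.* (p ∸ 1) ℕ.≤ degree β
    large {zero}  β big = z≤n
    large {suc n} β big = ℕ.+-mono-≤ (big zero) (large (λ i → β (suc i)) (λ i → big (suc i)))

  boxSum-polynomial≈0 : ∀ {m D} {f : Vec m → ℤ} → Polynomial≤ D f → D ℕ.< m ℕ.* (p ∸ 1) →
                        boxSum (λ u → f (point u)) ≈ 0ℤ
  boxSum-polynomial≈0 {m} nil _ = boxSum≈0 {m} (λ u → ≈-refl {0ℤ})
  boxSum-polynomial≈0 (term+ {f} c α dα P) D<m[p∸1] with small-exponent α (ℕ.≤-<-trans dα D<m[p∸1])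
  ... | i , 1+αᵢ<p = begin
    boxSum (λ u → c * monomial α (point u) + f (point u))
      ≈⟨ boxSum-+ (λ u → c * monomial α (point u)) (λ u → f (point u)) ⟩
    boxSum (λ u → c * monomial α (point u)) + boxSum (λ u → f (point u))
      ≈⟨ +-cong (boxSum-*ˡ c (λ u → monomial α (point u))) (boxSum-polynomial≈0 P D<m[p∸1]) ⟩
    c * boxSum (λ u → monomial α (point u)) + 0ℤ
      ≈⟨ +-congʳ {0ℤ} (*-congˡ {c} (≈-trans (boxSum-monomial α)
                                              (∏≈0 (λ i → powerSum (α i)) i (powerSum≈0 (α i) 1+αᵢ<p)))) ⟩
    c * 0ℤ + 0ℤ
      ≈⟨ +-congʳ {0ℤ} (zeroʳ c) ⟩
    0ℤ
      ∎
  boxSum-polynomial≈0 (resp f≈g P) D<m[p∸1] =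
    ≈-trans (boxSum-cong (λ u → ≈-sym (f≈g (point u)))) (boxSum-polynomial≈0 P D<m[p∸1])

  module _ {m d D} (Q : Fin d → Vec m → ℤ) (Q-polynomial : ∀ j → Polynomial≤ D (Q j)) where

    commonZeroIndicator : Vec m → ℤ
    commonZeroIndicator x = ∏ (λ j → 1ℤ - Q j x ^ (p ∸ 1))

    commonZeroIndicator-polynomial : Polynomial≤ (d ℕ.* ((p ∸ 1) ℕ.* D)) commonZeroIndicator
    commonZeroIndicator-polynomial = ∏-polynomial (λ j → +-polynomial (const-polynomial 1ℤ)
      (resp (λ x → ≡⇒≈ (ℤ.-1*i≡-i (Q j x ^ (p ∸ 1))))
            (*-polynomial (const-polynomial {D = 0} (- 1ℤ)) (^-polynomial (p ∸ 1) (Q-polynomial j)))))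

    commonZeroIndicator≈0 : ∀ x j → ¬ Q j x ≈ 0ℤ → commonZeroIndicator x ≈ 0ℤ
    commonZeroIndicator≈0 x j Qⱼ[x]≉0 = ∏≈0 (λ j → 1ℤ - Q j x ^ (p ∸ 1)) j (1-x^[p-1]≈0 Qⱼ[x]≉0)

    commonZeroIndicator≈1 : ∀ x → (∀ j → Q j x ≈ 0ℤ) → commonZeroIndicator x ≈ 1ℤ
    commonZeroIndicator≈1 x Q[x]≈0 = ∏≈1 (λ j → 1-x^[p-1]≈1 (Q[x]≈0 j))

  chevalley : ∀ {m d D} (Q : Fin d → Vec m → ℤ) → (∀ j → Polynomial≤ D (Q j)) →
              (∀ j → Q j (λ _ → 0ℤ) ≈ 0ℤ) → d ℕ.* D ℕ.< m →
              Σ (Vec m) (λ x → Σ (Fin m) (λ i → ¬ x i ≈ 0ℤ) × (∀ j → Q j x ≈ 0ℤ))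
  chevalley {m} {d} {D} Q Q-polynomial Q[0]≈0 dD<m
    with search (λ u → nonzero? u ×-dec all? (λ j → Q j (point u) ≈? 0ℤ))
    where
    nonzero? : (u : Box m) → Dec (Nonzero u)
    nonzero? u = any? (λ i → ¬? (V.lookup u i Fin.≟ zeroᶠ))
  ... | yes (u , (i , uᵢ≢0) , Q[u]≈0) = point u , (i , point-≉0 u i uᵢ≢0) , Q[u]≈0
  ... | no none = contradiction 1≈0 1≉0
    where
    F = commonZeroIndicator Q Q-polynomial
    F[u]≈0 : ∀ u → Nonzero u → F (point u) ≈ 0ℤ
    F[u]≈0 u u≢0 with ¬∀⟶∃¬ d _ (λ j → Q j (point u) ≈? 0ℤ) (λ Q[u]≈0 → none (u , u≢0 , Q[u]≈0))
    ... | j , Qⱼ[u]≉0 = commonZeroIndicator≈0 Q Q-polynomial (point u) j Qⱼ[u]≉0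
    Q[origin]≈0 : ∀ j → Q j (point origin) ≈ 0ℤ
    Q[origin]≈0 j = ≈-trans (polynomial-cong (Q-polynomial j) (λ i → ≡⇒≈ (point-origin i))) (Q[0]≈0 j)
    deg-F<m[p∸1] : d ℕ.* ((p ∸ 1) ℕ.* D) ℕ.< m ℕ.* (p ∸ 1)
    deg-F<m[p∸1] = subst (ℕ._< m ℕ.* (p ∸ 1)) (lemma d D (p ∸ 1)) (ℕ.*-monoˡ-< (p ∸ 1) {{ℕ.>-nonZero 0<p∸1}} dD<m)
      where
      lemma : ∀ d D q → d ℕ.* D ℕ.* q ≡ d ℕ.* (q ℕ.* D)
      lemma = solve-∀
    1≈0 : 1ℤ ≈ 0ℤ
    1≈0 = begin
      1ℤ                         ≈⟨ commonZeroIndicator≈1 Q Q-polynomial (point origin) Q[origin]≈0 ⟨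
      F (point origin)           ≈⟨ boxSum-origin (λ u → F (point u)) F[u]≈0 ⟨
      boxSum (λ u → F (point u)) ≈⟨ boxSum-polynomial≈0 (commonZeroIndicator-polynomial Q Q-polynomial) deg-F<m[p∸1] ⟩
      0ℤ                         ∎

module Vectors (p : ℕ) where

  open import Algebra.Bundles using (CommutativeRing)
  open import Data.Fin.Base using (Fin; zero; suc)
  open import Data.Integer.Base using (ℤ; _*_; 0ℤ; 1ℤ)
  open import Function.Base using (_∘_)
  open import Relation.Nullary.Negation using (contradiction)
  open import Relation.Binary.PropositionalEquality using (_≡_; _≢_; refl; sym; cong)
  open import Defs using (Vec; ∑; dot; comb)
  open Modular p
  open Sums p

  open CommutativeRing ℤ/p using (setoid; *-congʳ; *-assoc; *-identityˡ; *-identityʳ; zeroˡ; zeroʳ)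
  open import Relation.Binary.Reasoning.Setoid setoid

  dot-congˡ : ∀ {n} {x x′ : Vec n} (y : Vec n) → (∀ i → x i ≈ x′ i) → dot x y ≈ dot x′ y
  dot-congˡ y x≈x′ = ∑-cong (λ i → *-congʳ {y i} (x≈x′ i))

  comb-congʳ : ∀ {n k} (w : Fin k → Vec n) {a b : Fin k → ℤ} → (∀ u → a u ≈ b u) → ∀ j → comb w a j ≈ comb w b j
  comb-congʳ w a≈b j = ∑-cong (λ u → *-congʳ {w u j} (a≈b u))

  dot-combˡ : ∀ {n k} (w : Fin k → Vec n) a y → dot (comb w a) y ≈ ∑ (λ u → a u * dot (w u) y)
  dot-combˡ {n} {k} w a y = begin
    ∑ (λ l → ∑ (λ u → a u * w u l) * y l)
      ≈⟨ ∑-cong {n} (λ l → *-distribʳ-∑ {k} (y l) (λ u → a u * w u l)) ⟩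
    ∑ (λ l → ∑ (λ u → a u * w u l * y l))
      ≈⟨ ∑-comm {n} {k} (λ l u → a u * w u l * y l) ⟩
    ∑ (λ u → ∑ (λ l → a u * w u l * y l))
      ≈⟨ ∑-cong {k} (λ u → ≈-trans (∑-cong {n} (λ l → *-assoc (a u) (w u l) (y l)))
                                   (≈-sym (*-distribˡ-∑ (a u) (λ l → w u l * y l)))) ⟩
    ∑ (λ u → a u * dot (w u) y)
      ∎

  comb-comb : ∀ {n k l} (P : Fin l → Vec n) (w : Fin k → Vec l) a j →
              comb (λ u → comb P (w u)) a j ≈ comb P (comb w a) j
  comb-comb P w a j = ≈-sym (dot-combˡ w a (λ v → P v j))

  basis : ∀ {n} → Fin n → Vec n
  basis zero    zero    = 1ℤ
  basis zero    (suc _) = 0ℤ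
  basis (suc i) zero    = 0ℤ
  basis (suc i) (suc j) = basis i j

  basis-diag : ∀ {n} (i : Fin n) → basis i i ≡ 1ℤ
  basis-diag zero    = refl
  basis-diag (suc i) = basis-diag i

  basis-≢ : ∀ {n} {i j : Fin n} → i ≢ j → basis i j ≡ 0ℤ
  basis-≢ {i = zero}  {zero}  i≢j = contradiction refl i≢j
  basis-≢ {i = zero}  {suc j} _   = refl
  basis-≢ {i = suc i} {zero}  _   = refl
  basis-≢ {i = suc i} {suc j} i≢j = basis-≢ (λ i≡j → i≢j (cong suc i≡j))

  dot-basis : ∀ {n} (i : Fin n) y → dot (basis i) y ≈ y i
  dot-basis i y = ≈-trans
    (∑-single (λ l → basis i l * y l) i
              (λ l l≢i → ≈-trans (≡⇒≈ (cong (_* y l) (basis-≢ (l≢i ∘ sym)))) (zeroˡ (y l))))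
    (≈-trans (≡⇒≈ (cong (_* y i) (basis-diag i))) (*-identityˡ (y i)))

  comb-basis : ∀ {n} (x : Vec n) j → comb basis x j ≈ x j
  comb-basis x j = ≈-trans
    (∑-single (λ i → x i * basis i j) j
              (λ i i≢j → ≈-trans (≡⇒≈ (cong (x i *_) (basis-≢ i≢j))) (zeroʳ (x i))))
    (≈-trans (≡⇒≈ (cong (x j *_) (basis-diag j))) (*-identityʳ (x j)))

module BilinearForms (p : ℕ) where

  open import Algebra.Bundles using (CommutativeRing)
  open import Data.Fin.Base using (Fin; zero; suc)
  open import Data.Integer.Base using (ℤ; _+_; _*_; 0ℤ)
  open import Data.Nat.Base using (zero; suc)
  open import Defs using (Vec; ∑; dot; comb; IsLinear; SelfAdjoint; _+ᵥ_; _·ᵥ_)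
  open Modular p
  open Sums p
  open Vectors p
  open Polynomials p

  open CommutativeRing ℤ/p using (setoid; +-cong; *-congˡ; *-comm; zeroʳ)
  open import Relation.Binary.Reasoning.Setoid setoid

  record IsSymmetricBilinear {n} (B : Vec n → Vec n → ℤ) : Set where
    field
      congˡ     : ∀ {x x′} y → (∀ i → x i ≈ x′ i) → B x y ≈ B x′ y
      linearˡ   : ∀ {k} (w : Fin k → Vec n) a y → B (comb w a) y ≈ ∑ (λ u → a u * B (w u) y)
      symmetric : ∀ x y → B x y ≈ B y x

    congʳ : ∀ x {y y′} → (∀ i → y i ≈ y′ i) → B x y ≈ B x y′
    congʳ x {y} {y′} y≈y′ = ≈-trans (symmetric x y) (≈-trans (congˡ x y≈y′) (symmetric y′ x))

    linearʳ : ∀ {k} x (w : Fin k → Vec n) b → B x (comb w b) ≈ ∑ (λ v → b v * B x (w v))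
    linearʳ {k} x w b = ≈-trans (symmetric x (comb w b))
      (≈-trans (linearˡ w b x) (∑-cong {k} (λ v → *-congˡ {b v} (symmetric (w v) x))))

    as-dot : ∀ x y → B x y ≈ dot (λ l → B x (basis l)) y
    as-dot x y = begin
      B x y                             ≈⟨ congʳ x (λ i → ≈-sym (comb-basis y i)) ⟩
      B x (comb basis y)                ≈⟨ linearʳ x basis y ⟩
      ∑ {n} (λ l → y l * B x (basis l)) ≈⟨ ∑-cong {n} (λ l → *-comm (y l) (B x (basis l))) ⟩
      dot (λ l → B x (basis l)) y       ∎

    isotropic-span : ∀ {k} (w : Fin k → Vec n) → (∀ u v → B (w u) (w v) ≈ 0ℤ) →
                     ∀ a b → B (comb w a) (comb w b) ≈ 0ℤ
    isotropic-span w w⊥w a b = ≈-trans (linearˡ w a (comb w b)) (∑≈0 (λ u →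
      ≈-trans (*-congˡ {a u} (≈-trans (linearʳ (w u) w b) (∑≈0 (λ v →
        ≈-trans (*-congˡ {b v} (w⊥w u v)) (zeroʳ (b v))))))
      (zeroʳ (a u))))

    quadratic-polynomial : Polynomial≤ 2 (λ x → B x x)
    quadratic-polynomial = resp (λ x → ≈-sym (expansion x))
      (∑-polynomial (λ i → *-polynomial (var-polynomial i)
        (∑-polynomial (λ l → *-polynomial (var-polynomial l) (const-polynomial (B (basis i) (basis l)))))))
      where
      expansion : ∀ x → B x x ≈ ∑ (λ i → x i * ∑ (λ l → x l * B (basis i) (basis l)))
      expansion x = begin
        B x x                                                     ≈⟨ congˡ x (λ i → ≈-sym (comb-basis x i)) ⟩
        B (comb basis x) x                                        ≈⟨ linearˡ basis x x ⟩
        ∑ {n} (λ i → x i * B (basis i) x)                         ≈⟨ ∑-cong {n} (λ i → *-congˡ {x i} (≈-trans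
                                                                       (congʳ (basis i) (λ l → ≈-sym (comb-basis x l)))
                                                                       (linearʳ (basis i) basis x))) ⟩
        ∑ {n} (λ i → x i * ∑ (λ l → x l * B (basis i) (basis l))) ∎

  pullback : ∀ {n m} → (Vec n → Vec n → ℤ) → (Fin m → Vec n) → Vec m → Vec m → ℤ
  pullback B P a b = B (comb P a) (comb P b)

  pullback-isSymmetricBilinear : ∀ {n m} {B : Vec n → Vec n → ℤ} (P : Fin m → Vec n) →
                                 IsSymmetricBilinear B → IsSymmetricBilinear (pullback B P)
  pullback-isSymmetricBilinear P B-bilinear = record
    { congˡ     = λ y a≈a′ → congˡ (comb P y) (comb-congʳ P a≈a′)
    ; linearˡ   = λ w a y → ≈-trans (congˡ (comb P y) (λ j → ≈-sym (comb-comb P w a j)))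
                                    (linearˡ (λ u → comb P (w u)) a (comb P y))
    ; symmetric = λ a b → symmetric (comb P a) (comb P b)
    }
    where open IsSymmetricBilinear B-bilinear

  module _ {n} {M : Vec n → Vec n} (M-linear : IsLinear p M) where
    private
      M-additive : ∀ x y j → M (x +ᵥ y) j ≈ M x j + M y j
      M-additive x y j = ≈[]⇒≈ (IsLinear.additive M-linear x y j)

      M-homogeneous : ∀ c x j → M (c ·ᵥ x) j ≈ c * M x j
      M-homogeneous c x j = ≈[]⇒≈ (IsLinear.homogeneous M-linear c x j)

      M-cong : ∀ {x x′} → (∀ i → x i ≈ x′ i) → ∀ j → M x j ≈ M x′ j
      M-cong {x} {x′} x≈x′ j = ≈[]⇒≈ (IsLinear.resp M-linear x x′ (λ i → ≈⇒≈[] (x≈x′ i)) j)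

    linear-comb : ∀ {k} (w : Fin k → Vec n) a j → M (comb w a) j ≈ comb (λ u → M (w u)) a j
    linear-comb {zero}  w a j = M-homogeneous 0ℤ (λ _ → 0ℤ) j
    linear-comb {suc k} w a j = begin
      M (comb w a) j
        ≈⟨ M-additive (a zero ·ᵥ w zero) (comb w′ a′) j ⟩
      M (a zero ·ᵥ w zero) j + M (comb w′ a′) j
        ≈⟨ +-cong (M-homogeneous (a zero) (w zero) j) (linear-comb w′ a′ j) ⟩
      a zero * M (w zero) j + comb (λ u → M (w′ u)) a′ j
        ∎
      where
      w′ : Fin k → Vec n
      w′ u = w (suc u)
      a′ : Fin k → ℤ
      a′ u = a (suc u)

    selfAdjoint-isSymmetricBilinear : SelfAdjoint p M → IsSymmetricBilinear (λ x y → dot (M x) y)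
    selfAdjoint-isSymmetricBilinear M-selfAdjoint = record
      { congˡ     = λ y x≈x′ → dot-congˡ y (M-cong x≈x′)
      ; linearˡ   = λ w a y → ≈-trans (dot-congˡ y (linear-comb w a)) (dot-combˡ (λ u → M (w u)) a y)
      ; symmetric = λ x y → ≈[]⇒≈ (M-selfAdjoint x y)
      }

module LinearAlgebra (p : ℕ) (p-prime : Prime p) where

  open import Algebra.Bundles using (CommutativeRing)
  open import Data.Fin.Base using (Fin; zero; suc; punchIn)
  open import Data.Fin.Properties using (any?)
  open import Data.Integer.Base using (ℤ; _+_; _*_; -_; 0ℤ; 1ℤ)
  import Data.Integer.Properties as ℤ
  open import Data.Integer.Tactic.RingSolver using (solve-∀)
  open import Data.Nat.Base as ℕ using (zero; suc)
  open import Data.Product.Base using (Σ; _×_; _,_; proj₁; proj₂)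
  open import Data.Vec.Functional using (_∷_; insertAt; removeAt)
  open import Data.Vec.Functional.Properties using (insertAt-lookup; insertAt-punchIn)
  open import Relation.Nullary.Decidable using (yes; no; ¬?; decidable-stable)
  open import Relation.Nullary.Negation using (¬_)
  open import Relation.Binary.PropositionalEquality using (_≡_; sym; cong)
  open import Defs using (Vec; ∑; dot; comb; LinIndep)
  open Modular p
  open Sums p
  open PrimeField p p-prime
  open Vectors p

  open CommutativeRing ℤ/p using (setoid; -‿cong; +-cong; +-congˡ; +-congʳ; *-congˡ; *-congʳ; *-comm; *-assoc;
    +-identityˡ; +-identityʳ; zeroˡ; zeroʳ)
  open import Relation.Binary.Reasoning.Setoid setoid

  Independent : ∀ {n k} → (Fin k → Vec n) → Set
  Independent w = ∀ a → (∀ j → comb w a j ≈ 0ℤ) → ∀ i → a i ≈ 0ℤ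

  Independent⇒LinIndep : ∀ {n k} {w : Fin k → Vec n} → Independent w → LinIndep p w
  Independent⇒LinIndep w-independent a w[a]≈0 i = ≈⇒≈[] (w-independent a (λ j → ≈[]⇒≈ (w[a]≈0 j)) i)

  basis-independent : ∀ {n} → Independent (basis {n})
  basis-independent a basis[a]≈0 i = ≈-trans (≈-sym (comb-basis a i)) (basis[a]≈0 i)

  Independent-∘ : ∀ {n l k} {P : Fin l → Vec n} {w : Fin k → Vec l} →
                  Independent P → Independent w → Independent (λ u → comb P (w u))
  Independent-∘ {P = P} {w} P-independent w-independent a Pw[a]≈0 =
    w-independent a (P-independent (comb w a) (λ j → ≈-trans (≈-sym (comb-comb P w a j)) (Pw[a]≈0 j)))

  Independent-∷ : ∀ {n k} {x : Vec n} {w : Fin k → Vec n} i → ¬ x i ≈ 0ℤ → (∀ u → w u i ≈ 0ℤ) →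
                  Independent w → Independent (x ∷ w)
  Independent-∷ {x = x} {w} i xᵢ≉0 wᵢ≈0 w-independent a xw[a]≈0 = λ where
      zero    → a₀≈0
      (suc u) → w-independent a′ w[a′]≈0 u
    where
    a′ : Fin _ → ℤ
    a′ u = a (suc u)
    w[a′]ᵢ≈0 : comb w a′ i ≈ 0ℤ
    w[a′]ᵢ≈0 = ∑≈0 (λ u → ≈-trans (*-congˡ {a′ u} (wᵢ≈0 u)) (zeroʳ (a′ u)))
    a₀≈0 : a zero ≈ 0ℤ
    a₀≈0 = *-cancelˡ-≈0 xᵢ≉0 (begin
      x i * a zero               ≈⟨ *-comm (x i) (a zero) ⟩
      a zero * x i               ≈⟨ +-identityʳ (a zero * x i) ⟨
      a zero * x i + 0ℤ          ≈⟨ +-congˡ {a zero * x i} w[a′]ᵢ≈0 ⟨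
      a zero * x i + comb w a′ i ≈⟨ xw[a]≈0 i ⟩
      0ℤ                         ∎)
    w[a′]≈0 : ∀ j → comb w a′ j ≈ 0ℤ
    w[a′]≈0 j = begin
      comb w a′ j                ≈⟨ +-identityˡ (comb w a′ j) ⟨
      0ℤ + comb w a′ j           ≈⟨ +-congʳ {comb w a′ j} (≈-trans (*-congʳ {x j} a₀≈0) (zeroˡ (x j))) ⟨
      a zero * x j + comb w a′ j ≈⟨ xw[a]≈0 j ⟩
      0ℤ                         ∎

  private
    dot-insertAt : ∀ {n} (c : Vec (suc n)) (z : Vec n) i t → dot c (insertAt z i t) ≈ c i * t + dot (removeAt c i) z
    dot-insertAt {n} c z i t = ≈-trans (∑-remove (λ l → c l * insertAt z i t l) i)
      (+-cong (≡⇒≈ (cong (c i *_) (insertAt-lookup z i t)))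
              (∑-cong {n} (λ l → ≡⇒≈ (cong (c (punchIn i l) *_) (insertAt-punchIn z i t l)))))

    -- One condition for both cases: either c i is invertible and s = −(c i)⁻¹, or c vanishes and s = 0.
    pivot : ∀ {n} (c : Vec (suc n)) →
            Σ (Fin (suc n)) (λ i → Σ ℤ (λ s → ∀ l → (c i * s + 1ℤ) * c (punchIn i l) ≈ 0ℤ))
    pivot c with any? (λ i → ¬? (c i ≈? 0ℤ))
    ... | yes (i , cᵢ≉0) = i , - y , (λ l → ≈-trans (*-congʳ {c (punchIn i l)} cᵢs+1≈0) (zeroˡ (c (punchIn i l))))
      where
      y = proj₁ (inverse cᵢ≉0)
      cᵢs+1≈0 : c i * - y + 1ℤ ≈ 0ℤ
      cᵢs+1≈0 = ≈-trans (≡⇒≈ (cong (_+ 1ℤ) (sym (ℤ.neg-distribʳ-* (c i) y))))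
                        (+-congʳ {1ℤ} (-‿cong (proj₂ (inverse cᵢ≉0))))
    ... | no none = zero , 0ℤ , λ l →
      ≈-trans (*-congˡ {c zero * 0ℤ + 1ℤ} (decidable-stable (c (suc l) ≈? 0ℤ) (λ cₗ≉0 → none (suc l , cₗ≉0))))
              (zeroʳ (c zero * 0ℤ + 1ℤ))

  -- Gaussian elimination: lift solves the first equation for the pivot coordinate i, so the
  -- remaining r equations become equations in the other coordinates.
  kernel : ∀ r m (c : Fin r → Vec (r ℕ.+ m)) →
           Σ (Fin m → Vec (r ℕ.+ m)) (λ P → Independent P × (∀ i u → dot (c i) (P u) ≈ 0ℤ))
  kernel zero    m c = basis , basis-independent , (λ ())
  kernel (suc r) m c = (λ u → lift (P′ u)) , lift-independent , lift⊥c
    where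
    c₀ = c zero
    i = proj₁ (pivot c₀)
    s = proj₁ (proj₂ (pivot c₀))
    pivotal = proj₂ (proj₂ (pivot c₀))
    c₀′ = removeAt c₀ i
    lift : Vec (r ℕ.+ m) → Vec (suc r ℕ.+ m)
    lift z = insertAt z i (s * dot c₀′ z)
    restrict : Fin r → Vec (r ℕ.+ m)
    restrict k l = c (suc k) i * s * c₀′ l + c (suc k) (punchIn i l)
    P′ = proj₁ (kernel r m restrict)
    P′-independent = proj₁ (proj₂ (kernel r m restrict))
    P′⊥restrict = proj₂ (proj₂ (kernel r m restrict))

    lift-independent : Independent (λ u → lift (P′ u))
    lift-independent a lift[a]≈0 = P′-independent a (λ l → ≈-trans
      (∑-cong (λ u → ≡⇒≈ (cong (a u *_) (sym (insertAt-punchIn (P′ u) i _ l))))) (lift[a]≈0 (punchIn i l)))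

    lift⊥c₀ : ∀ z → dot c₀ (lift z) ≈ 0ℤ
    lift⊥c₀ z = begin
      dot c₀ (lift z)
        ≈⟨ dot-insertAt c₀ z i (s * dot c₀′ z) ⟩
      c₀ i * (s * dot c₀′ z) + dot c₀′ z
        ≡⟨ lemma (c₀ i) s (dot c₀′ z) ⟩
      (c₀ i * s + 1ℤ) * dot c₀′ z
        ≈⟨ *-distribˡ-∑ (c₀ i * s + 1ℤ) (λ l → c₀′ l * z l) ⟩
      ∑ (λ l → (c₀ i * s + 1ℤ) * (c₀′ l * z l))
        ≈⟨ ∑≈0 (λ l → ≈-trans (≈-sym (*-assoc (c₀ i * s + 1ℤ) (c₀′ l) (z l)))
                              (≈-trans (*-congʳ {z l} (pivotal l)) (zeroˡ (z l)))) ⟩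
      0ℤ
        ∎
      where
      lemma : ∀ a s t → a * (s * t) + t ≡ (a * s + 1ℤ) * t
      lemma = solve-∀

    lift-restrict : ∀ k z → dot (c (suc k)) (lift z) ≈ dot (restrict k) z
    lift-restrict k z = begin
      dot cₖ (lift z)
        ≈⟨ dot-insertAt cₖ z i (s * dot c₀′ z) ⟩
      cₖ i * (s * dot c₀′ z) + dot (removeAt cₖ i) z
        ≈⟨ +-congʳ {dot (removeAt cₖ i) z} (≈-trans (≈-sym (*-assoc (cₖ i) s (dot c₀′ z)))
                                                    (*-distribˡ-∑ (cₖ i * s) (λ l → c₀′ l * z l))) ⟩
      ∑ (λ l → cₖ i * s * (c₀′ l * z l)) + dot (removeAt cₖ i) z
        ≈⟨ ∑-distrib-+ (λ l → cₖ i * s * (c₀′ l * z l)) (λ l → cₖ (punchIn i l) * z l) ⟨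
      ∑ (λ l → cₖ i * s * (c₀′ l * z l) + cₖ (punchIn i l) * z l)
        ≈⟨ ∑-cong (λ l → ≡⇒≈ (lemma (cₖ i * s) (c₀′ l) (cₖ (punchIn i l)) (z l))) ⟩
      dot (restrict k) z
        ∎
      where
      cₖ = c (suc k)
      lemma : ∀ a b c z → a * (b * z) + c * z ≡ (a * b + c) * z
      lemma = solve-∀

    lift⊥c : ∀ k u → dot (c k) (lift (P′ u)) ≈ 0ℤ
    lift⊥c zero    u = lift⊥c₀ (P′ u)
    lift⊥c (suc k) u = ≈-trans (lift-restrict k (P′ u)) (P′⊥restrict k u)

module IsotropicSubspaces (p : ℕ) (p-prime : Prime p) where

  open import Algebra.Bundles using (CommutativeRing)
  open import Data.Fin.Base using (Fin; zero; suc)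
  open import Data.Integer.Base using (ℤ; _*_; 0ℤ)
  open import Data.Nat.Base as ℕ using (zero; suc)
  import Data.Nat.Properties as ℕ
  open import Data.Nat.Induction using (<-rec)
  open import Data.Nat.Tactic.RingSolver using (solve-∀)
  open import Data.Product.Base using (Σ; _×_; _,_; proj₁; proj₂)
  open import Data.Vec.Functional using (_∷_)
  open import Relation.Nullary.Decidable using (yes; no)
  open import Relation.Nullary.Negation using (¬_)
  open import Relation.Binary.PropositionalEquality using (_≡_; refl; sym; subst)
  open import Defs using (Vec; dot; comb; IsLinear; SelfAdjoint)
  open Modular p
  open Sums p
  open Vectors p
  open BilinearForms p
  open LinearAlgebra p p-prime
  open Chevalley p p-prime

  open CommutativeRing ℤ/p using (*-congˡ; zeroʳ)

  TotallyIsotropic : ∀ {m d k} → (Fin d → Vec m → Vec m → ℤ) → (Fin k → Vec m) → Set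
  TotallyIsotropic B w = ∀ j u v → B j (w u) (w v) ≈ 0ℤ

  LargeIsotropicFamily : ∀ {d} m → (Fin d → Vec m → Vec m → ℤ) → Set
  LargeIsotropicFamily {d} m B = Σ ℕ (λ k → Σ (Fin k → Vec m) (λ w →
    Independent w × m ℕ.≤ suc d ℕ.* k ℕ.+ 2 ℕ.* d × TotallyIsotropic B w))

  module _ {d m} (B : Fin d → Vec m → Vec m → ℤ) (B-bilinear : ∀ j → IsSymmetricBilinear (B j)) where
    private module B j = IsSymmetricBilinear (B-bilinear j)

    isotropic-vector : 2 ℕ.* d ℕ.< m → Σ (Vec m) (λ x → Σ (Fin m) (λ i → ¬ x i ≈ 0ℤ) × (∀ j → B j x x ≈ 0ℤ))
    isotropic-vector 2d<m = chevalley (λ j x → B j x x) (λ j → B.quadratic-polynomial j)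
      (λ j → B.linearˡ j {0} (λ ()) (λ ()) (λ _ → 0ℤ)) (subst (ℕ._< m) (ℕ.*-comm 2 d) 2d<m)

  module _ {d m′} (B : Fin d → Vec (suc d ℕ.+ m′) → Vec (suc d ℕ.+ m′) → ℤ)
           (B-bilinear : ∀ j → IsSymmetricBilinear (B j)) where
    private module B j = IsSymmetricBilinear (B-bilinear j)

    orthogonal-family : ∀ x i → Σ (Fin m′ → Vec (suc d ℕ.+ m′)) (λ P →
      Independent P × (∀ v → P v i ≈ 0ℤ) × (∀ j z → B j x (comb P z) ≈ 0ℤ))
    orthogonal-family x i = P , P-independent , Pᵢ≈0 , x⊥P
      where
      c : Fin (suc d) → Vec (suc d ℕ.+ m′)
      c zero    = basis i
      c (suc j) = λ l → B j x (basis l)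
      P = proj₁ (kernel (suc d) m′ c)
      P-independent = proj₁ (proj₂ (kernel (suc d) m′ c))
      P⊥c = proj₂ (proj₂ (kernel (suc d) m′ c))
      Pᵢ≈0 : ∀ v → P v i ≈ 0ℤ
      Pᵢ≈0 v = ≈-trans (≈-sym (dot-basis i (P v))) (P⊥c zero v)
      x⊥P : ∀ j z → B j x (comb P z) ≈ 0ℤ
      x⊥P j z = ≈-trans (B.linearʳ j x P z) (∑≈0 (λ v →
        ≈-trans (*-congˡ {z v} (≈-trans (B.as-dot j x (P v)) (P⊥c (suc j) v))) (zeroʳ (z v))))

    extend : 2 ℕ.* d ℕ.< suc d ℕ.+ m′ →
             (∀ B′ → (∀ j → IsSymmetricBilinear (B′ j)) → LargeIsotropicFamily m′ B′) →
             LargeIsotropicFamily (suc d ℕ.+ m′) B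
    extend 2d<m family′ = suc k , x ∷ Pw′ , independent , bound , isotropic
      where
      x = proj₁ (isotropic-vector B B-bilinear 2d<m)
      i = proj₁ (proj₁ (proj₂ (isotropic-vector B B-bilinear 2d<m)))
      xᵢ≉0 = proj₂ (proj₁ (proj₂ (isotropic-vector B B-bilinear 2d<m)))
      x⊥x = proj₂ (proj₂ (isotropic-vector B B-bilinear 2d<m))
      P = proj₁ (orthogonal-family x i)
      P-independent = proj₁ (proj₂ (orthogonal-family x i))
      Pᵢ≈0 = proj₁ (proj₂ (proj₂ (orthogonal-family x i)))
      x⊥P = proj₂ (proj₂ (proj₂ (orthogonal-family x i)))
      smaller = family′ (λ j → pullback (B j) P) (λ j → pullback-isSymmetricBilinear P (B-bilinear j))
      k = proj₁ smaller
      w′ = proj₁ (proj₂ smaller)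
      w′-independent = proj₁ (proj₂ (proj₂ smaller))
      w′-bound = proj₁ (proj₂ (proj₂ (proj₂ smaller)))
      w′-isotropic = proj₂ (proj₂ (proj₂ (proj₂ smaller)))
      Pw′ : Fin k → Vec (suc d ℕ.+ m′)
      Pw′ u = comb P (w′ u)
      -- The implicit arguments are given because inferring them would unfold the kernel construction.
      independent : Independent (x ∷ Pw′)
      independent = Independent-∷ {x = x} {w = Pw′} i xᵢ≉0
        (λ u → ∑≈0 (λ v → ≈-trans (*-congˡ {w′ u v} (Pᵢ≈0 v)) (zeroʳ (w′ u v))))
        (Independent-∘ {P = P} {w = w′} P-independent w′-independent)
      bound : suc d ℕ.+ m′ ℕ.≤ suc d ℕ.* suc k ℕ.+ 2 ℕ.* d
      bound = subst (suc d ℕ.+ m′ ℕ.≤_) (lemma d k) (ℕ.+-monoʳ-≤ (suc d) w′-bound)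
        where
        lemma : ∀ d k → suc d ℕ.+ (suc d ℕ.* k ℕ.+ 2 ℕ.* d) ≡ suc d ℕ.* suc k ℕ.+ 2 ℕ.* d
        lemma = solve-∀
      isotropic : TotallyIsotropic B (x ∷ Pw′)
      isotropic j zero    zero    = x⊥x j
      isotropic j zero    (suc v) = x⊥P j (w′ v)
      isotropic j (suc u) zero    = ≈-trans (B.symmetric j (Pw′ u) x) (x⊥P j (w′ u))
      isotropic j (suc u) (suc v) = w′-isotropic j u v

  isotropic-subspace : ∀ d m (B : Fin d → Vec m → Vec m → ℤ) → (∀ j → IsSymmetricBilinear (B j)) →
                       LargeIsotropicFamily m B
  isotropic-subspace d = <-rec _ step
    where
    split : ∀ {m} → 2 ℕ.* d ℕ.< m → Σ ℕ (λ m′ → suc d ℕ.+ m′ ≡ m)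
    split {m} 2d<m = m ℕ.∸ suc d , ℕ.m+[n∸m]≡n (ℕ.≤-trans (ℕ.s≤s (ℕ.m≤m+n d (d ℕ.+ 0))) 2d<m)
    step : ∀ m → (∀ {m′} → m′ ℕ.< m → ∀ B → (∀ j → IsSymmetricBilinear (B j)) → LargeIsotropicFamily m′ B) →
           ∀ B → (∀ j → IsSymmetricBilinear (B j)) → LargeIsotropicFamily m B
    step m smaller B B-bilinear with m ℕ.≤? 2 ℕ.* d
    ... | yes m≤2d =
      0 , (λ ()) , (λ _ _ ()) , subst (λ n → m ℕ.≤ n ℕ.+ 2 ℕ.* d) (sym (ℕ.*-zeroʳ (suc d))) m≤2d , (λ _ ())
    ... | no m≰2d with split (ℕ.≰⇒> m≰2d)
    ...   | m′ , refl = extend B B-bilinear (ℕ.≰⇒> m≰2d) (smaller (ℕ.m<n+m m′ (ℕ.s≤s ℕ.z≤n)))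

  selfAdjoint-isotropic-subspace : ∀ n d (M : Fin d → Vec n → Vec n) →
    (∀ j → IsLinear p (M j)) → (∀ j → SelfAdjoint p (M j)) →
    Σ ℕ (λ k → Σ (Fin k → Vec n) (λ w → Independent w × n ℕ.≤ suc d ℕ.* k ℕ.+ 2 ℕ.* d ×
      (∀ j a b → dot (M j (comb w a)) (comb w b) ≈ 0ℤ)))
  selfAdjoint-isotropic-subspace n d M M-linear M-selfAdjoint =
    let k , w , w-independent , bound , w-isotropic = isotropic-subspace d n (λ j x y → dot (M j x) y) forms
    in  k , w , w-independent , bound , λ j → IsSymmetricBilinear.isotropic-span (forms j) w (w-isotropic j)
    where
    forms : ∀ j → IsSymmetricBilinear (λ x y → dot (M j x) y)
    forms j = selfAdjoint-isSymmetricBilinear (M-linear j) (M-selfAdjoint j)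

open import Data.Nat using (ℕ; suc; _+_; _*_; _≤_)
open import Data.Nat.Primality using (Prime)
open import Data.Integer using (ℤ; +_)
open import Data.Fin using (Fin)
open import Data.Product using (Σ; _×_; _,_)
open import Defs

lemma7p2 : (p : ℕ) → Prime p → 5 ≤ p → (n d : ℕ) → (M : Fin d → Vec n → Vec n) →
    (∀ j → IsLinear p (M j)) → (∀ j → SelfAdjoint p (M j)) →
    Σ ℕ (λ k → Σ (Fin k → Vec n) (λ w →
      LinIndep p w × (n ≤ suc d * k + 2 * d) ×
      (∀ j (a b : Fin k → ℤ) → dot (M j (comb w a)) (comb w b) ≈[ p ] + 0)))
lemma7p2 p p-prime _ n d M M-linear M-selfAdjoint =
  let k , w , w-independent , bound , w-isotropic =
        IsotropicSubspaces.selfAdjoint-isotropic-subspace p p-prime n d M M-linear M-selfAdjoint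
  in  k , w , LinearAlgebra.Independent⇒LinIndep p p-prime w-independent , bound ,
      λ j a b → Modular.≈⇒≈[] p (w-isotropic j a b)
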